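{- Let $m\geq 3$. Then the graph $\mathrm{Cay}(\mathbb{Z}_m\times\mathbb{Z}_{16},\ \{\pm1\}\times\{8\})\cup mI_{11}'$ can be decomposed into a $C_{16}$-factor and a $1$-factor.
   Context: For a finite additive group $\Gamma$ and $S\subseteq\Gamma\setminus\{0\}$ closed under negatives, $\mathrm{Cay}(\Gamma,S)$ has vertex set $\Gamma$ and an edge between $a,b$ whenever $a-b\in S$; here $S=\{(1,8),(-1,8)\}\subseteq \mathbb{Z}_m\times\mathbb{Z}_{16}$. $I_{11}'=\{(0,10),(2,11),(3,15),(7,14),(6,13),(5,9),(1,12),(4,8)\}$ is a perfect matching of $K_{16}$ on vertex set $\mathbb{Z}_{16}$, and $mI_{11}'$ denotes the graph with vertex set $\mathbb{Z}_m\times\mathbb{Z}_{16}$ and edge set $\{\{(j,a),(j,b)\}: j\in\mathbb{Z}_m,\ (a,b)\in I_{11}'\}$. The union of graphs on the same vertex set has the union of their edge sets. A $C_{16}$-factor is a spanning subgraph each of whose components is a 16-cycle; a $1$-factor is a perfect matching; decomposing means partitioning the edge set into these factors. -}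

module Defs where

open import Data.Nat using (ℕ; zero; suc; _+_; _%_)
open import Data.Fin using (Fin; toℕ)
open import Data.Product using (Σ; _×_; _,_; proj₁; proj₂; ∃)
open import Data.Sum using (_⊎_)
open import Data.List using (List; []; _∷_)
open import Data.List.Membership.Propositional using (_∈_)
open import Relation.Binary.PropositionalEquality using (_≡_)
open import Relation.Nullary using (¬_)

V : ℕ → Set
V m = Fin m × Fin 16

Graph : ℕ → Set₁
Graph m = V m → V m → Set

-- b ≡ a + 1 (mod m), for a b < m
SuccMod : ℕ → ℕ → ℕ → Set
SuccMod m a b = (suc a ≡ b) ⊎ ((suc a ≡ m) × (b ≡ 0))

Cay : (m : ℕ) → Graph m
Cay m (x , y) (x' , y') =
  (SuccMod m (toℕ x) (toℕ x') ⊎ SuccMod m (toℕ x') (toℕ x))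
  × ((toℕ y + 8) % 16 ≡ toℕ y')

I11' : List (ℕ × ℕ)
I11' = (0 , 10) ∷ (2 , 11) ∷ (3 , 15) ∷ (7 , 14) ∷ (6 , 13) ∷ (5 , 9)
     ∷ (1 , 12) ∷ (4 , 8) ∷ []

mI11' : (m : ℕ) → Graph m
mI11' m (j , a) (j' , b) =
  (j ≡ j') × (((toℕ a , toℕ b) ∈ I11') ⊎ ((toℕ b , toℕ a) ∈ I11'))

_∪G_ : {m : ℕ} → Graph m → Graph m → Graph m
(G ∪G H) u v = G u v ⊎ H u v

CycNext : Fin 16 → Fin 16 → Set
CycNext i i' = toℕ i' ≡ suc (toℕ i) % 16

CyclesGraph : {m k : ℕ} → (Fin k → Fin 16 → V m) → Graph m
CyclesGraph {m} {k} cs u v =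
  Σ (Fin k) λ j → Σ (Fin 16) λ i → Σ (Fin 16) λ i' →
    CycNext i i' × ((cs j i ≡ u × cs j i' ≡ v) ⊎ (cs j i ≡ v × cs j i' ≡ u))

-- F is a C_16-factor: F is exactly the edge set of a family of 16-cycles
-- that are vertex-disjoint and cover every vertex exactly once (in
-- particular each cycle has 16 distinct vertices).
IsC16Factor : (m : ℕ) → Graph m → Set
IsC16Factor m F =
  Σ ℕ λ k → Σ (Fin k → Fin 16 → V m) λ cs →
    (∀ v → Σ (Fin k × Fin 16) λ p →
        (cs (proj₁ p) (proj₂ p) ≡ v)
        × (∀ q → cs (proj₁ q) (proj₂ q) ≡ v → q ≡ p))
    × (∀ u v → (F u v → CyclesGraph cs u v) × (CyclesGraph cs u v → F u v))

Is1Factor : (m : ℕ) → Graph m → Set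
Is1Factor m M =
  (∀ u v → M u v → M v u)
  × (∀ u → Σ (V m) λ v → M u v × (∀ w → M u w → w ≡ v))

DecompC16And1Factor : (m : ℕ) → Graph m → Set₁
DecompC16And1Factor m G =
  Σ (Graph m) λ F → Σ (Graph m) λ M →
    IsC16Factor m F × Is1Factor m M
    × (∀ u v → (G u v → F u v ⊎ M u v)
             × (F u v → G u v)
             × (M u v → G u v)
             × ¬ (F u v × M u v))

{-# OPTIONS --safe #-}
-- The labels Z_16 carry two perfect matchings, I'_11 and the antipodal matching a ~ a + 8,
-- and their union is a single 16-cycle (listed by `label`) alternating between them. Call a
-- label upper or lower so that I'_11 joins labels of the same kind and the antipodal matching
-- labels of different kinds. For every column j, lifting the label cycle with the lower labels
-- in column j and the upper ones in column j + 1 gives a 16-cycle of the graph; these m cycles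
-- partition the vertices and use every fibre edge and every Cayley edge (x , a) ~ (x + 1 , a + 8)
-- with a lower. The other Cayley edges, (x , a) ~ (x + 1 , a + 8) with a upper, form a perfect
-- matching, and m ≥ 3 makes x + 1 ≠ x - 1, so no edge is counted in both.
module Submission where

open import Defs
open import Data.Bool using (Bool; true; false; not)
open import Data.Bool.Properties using (not-¬) renaming (_≟_ to _≟ᵇ_)
open import Data.Empty using (⊥; ⊥-elim)
open import Data.Fin using (Fin; zero; suc; toℕ; fromℕ; fromℕ<; inject₁; lower₁; #_)
open import Data.Fin.Properties using (toℕ-injective; toℕ<n; toℕ-fromℕ; toℕ-inject₁; toℕ-lower₁; toℕ-fromℕ<; all?)
  renaming (_≟_ to _≟ᶠ_)
open import Data.Nat using (ℕ; zero; suc; _+_; _%_; _≤_; _<_; _≤ᵇ_; s≤s; _≟_)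
open import Data.Nat.DivMod using (%-distribˡ-+; [m+n]%n≡m%n; m<n⇒m%n≡m; m%n<n)
open import Data.Nat.Properties using (suc-injective; <-irrefl; +-assoc; m+1+n≢n)
open import Data.Product using (Σ; _×_; _,_; proj₁; proj₂)
open import Data.Product.Properties using (≡-dec)
open import Data.List.Membership.DecPropositional (≡-dec _≟_ _≟_) using (_∈_; _∈?_)
open import Data.Sum using (_⊎_; inj₁; inj₂; [_,_]′)
import Data.Sum
open import Data.Vec using ([]; _∷_; lookup)
open import Function using (id)
open import Function.Bundles using (_⇔_; mk⇔; Equivalence)
open import Relation.Binary.Construct.Closure.Symmetric using (SymClosure; fwd; bwd; symmetric)
import Relation.Binary.Construct.Closure.Symmetric as Sym
open import Relation.Binary.PropositionalEquality
  using (_≡_; refl; sym; trans; cong; cong₂; module ≡-Reasoning)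
open import Relation.Nullary using (¬_; Dec; yes; no)
open import Relation.Nullary.Decidable using (from-yes; _⊎-dec_; _→-dec_)

SuccMod-functional : ∀ {m a b c} → b < m → c < m → SuccMod m a b → SuccMod m a c → b ≡ c
SuccMod-functional _   _   (inj₁ e)       (inj₁ e′)       = trans (sym e) e′
SuccMod-functional b<m _   (inj₁ e)       (inj₂ (e′ , _)) = ⊥-elim (<-irrefl (trans (sym e) e′) b<m)
SuccMod-functional _   c<m (inj₂ (e , _)) (inj₁ e′)       = ⊥-elim (<-irrefl (trans (sym e′) e) c<m)
SuccMod-functional _   _   (inj₂ (_ , e)) (inj₂ (_ , e′)) = trans e (sym e′)

SuccMod-injective : ∀ {m a b c} → SuccMod m a c → SuccMod m b c → a ≡ b
SuccMod-injective (inj₁ e)          (inj₁ e′)       = suc-injective (trans e (sym e′))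
SuccMod-injective (inj₁ refl)       (inj₂ (_ , ()))
SuccMod-injective (inj₂ (_ , refl)) (inj₁ ())
SuccMod-injective (inj₂ (e , _))    (inj₂ (e′ , _)) = suc-injective (trans e (sym e′))

-- Agda sees that the remaining case, where both steps wrap around, forces m = 1.
SuccMod-asymmetric : ∀ {m a b} → 3 ≤ m → SuccMod m a b → SuccMod m b a → ⊥
SuccMod-asymmetric _ (inj₁ refl) (inj₁ e) = m+1+n≢n 1 e
SuccMod-asymmetric (s≤s (s≤s ())) (inj₁ refl) (inj₂ (refl , refl))
SuccMod-asymmetric (s≤s (s≤s ())) (inj₂ (refl , refl)) (inj₁ refl)

Succ : ∀ {m} → Fin m → Fin m → Set
Succ {m} x y = SuccMod m (toℕ x) (toℕ y)

succ : ∀ {k} → Fin (suc k) → Fin (suc k)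
succ {k} x with k ≟ toℕ x
... | yes _    = zero
... | no k≢x = suc (lower₁ x k≢x)

pred : ∀ {k} → Fin (suc k) → Fin (suc k)
pred {k} zero    = fromℕ k
pred     (suc y) = inject₁ y

Succ-succ : ∀ {k} (x : Fin (suc k)) → Succ x (succ x)
Succ-succ {k} x with k ≟ toℕ x
... | yes k≡x = inj₂ (cong suc (sym k≡x) , refl)
... | no k≢x  = inj₁ (cong suc (sym (toℕ-lower₁ x k≢x)))

Succ-pred : ∀ {k} (y : Fin (suc k)) → Succ (pred y) y
Succ-pred {k} zero    = inj₂ (cong suc (toℕ-fromℕ k) , refl)
Succ-pred     (suc y) = inj₁ (cong suc (toℕ-inject₁ y))

Succ⇒≡succ : ∀ {k} {x y : Fin (suc k)} → Succ x y → y ≡ succ x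
Succ⇒≡succ {x = x} {y} s = toℕ-injective (SuccMod-functional (toℕ<n y) (toℕ<n (succ x)) s (Succ-succ x))

Succ⇒≡pred : ∀ {k} {x y : Fin (suc k)} → Succ x y → x ≡ pred y
Succ⇒≡pred {y = y} s = toℕ-injective (SuccMod-injective s (Succ-pred y))

succ-pred : ∀ {k} (y : Fin (suc k)) → succ (pred y) ≡ y
succ-pred y = sym (Succ⇒≡succ (Succ-pred y))

pred-succ : ∀ {k} (x : Fin (suc k)) → pred (succ x) ≡ x
pred-succ x = sym (Succ⇒≡pred (Succ-succ x))

CycAdjacent : Fin 16 → Fin 16 → Set
CycAdjacent i i′ = CycNext i i′ ⊎ CycNext i′ i

module _ {m k : ℕ} (cs : Fin k → Fin 16 → V m) (place : V m → Fin k × Fin 16)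
         (cs-place : ∀ v → cs (proj₁ (place v)) (proj₂ (place v)) ≡ v)
         (place-cs : ∀ j i → place (cs j i) ≡ (j , i)) where

  visited-once : ∀ v → Σ (Fin k × Fin 16) λ p →
    (cs (proj₁ p) (proj₂ p) ≡ v) × (∀ q → cs (proj₁ q) (proj₂ q) ≡ v → q ≡ p)
  visited-once v = place v , cs-place v , λ { (j , i) refl → sym (place-cs j i) }

  Consecutive : V m → V m → Set
  Consecutive u v =
    proj₁ (place u) ≡ proj₁ (place v) × CycAdjacent (proj₂ (place u)) (proj₂ (place v))

  CyclesGraph⇔Consecutive : ∀ u v → CyclesGraph cs u v ⇔ Consecutive u v
  CyclesGraph⇔Consecutive u v = mk⇔ to from
    where
    to : CyclesGraph cs u v → Consecutive u v
    to (j , i , i′ , next , inj₁ (refl , refl)) rewrite place-cs j i | place-cs j i′ = refl , inj₁ next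
    to (j , i , i′ , next , inj₂ (refl , refl)) rewrite place-cs j i | place-cs j i′ = refl , inj₂ next
    from : Consecutive u v → CyclesGraph cs u v
    from (same , inj₁ next) = proj₁ (place u) , proj₂ (place u) , proj₂ (place v) , next ,
      inj₁ (cs-place u , trans (cong (λ j → cs j (proj₂ (place v))) same) (cs-place v))
    from (same , inj₂ next) = proj₁ (place u) , proj₂ (place v) , proj₂ (place u) , next ,
      inj₂ (trans (cong (λ j → cs j (proj₂ (place v))) same) (cs-place v) , cs-place u)

CyclesGraph-sym : ∀ {m k} {cs : Fin k → Fin 16 → V m} {u v} → CyclesGraph cs u v → CyclesGraph cs v u
CyclesGraph-sym (j , i , i′ , next , inj₁ e) = j , i , i′ , next , inj₂ e
CyclesGraph-sym (j , i , i′ , next , inj₂ e) = j , i , i′ , next , inj₁ e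

Matched : Fin 16 → Fin 16 → Set
Matched a b = (toℕ a , toℕ b) ∈ I11' ⊎ (toℕ b , toℕ a) ∈ I11'

Antipodal : Fin 16 → Fin 16 → Set
Antipodal a b = (toℕ a + 8) % 16 ≡ toℕ b

Antipodal-sym : ∀ a b → Antipodal a b → Antipodal b a
Antipodal-sym a b ab = begin
  (toℕ b + 8) % 16                   ≡⟨ cong (λ n → (n + 8) % 16) ab ⟨
  ((toℕ a + 8) % 16 + 8 % 16) % 16   ≡⟨ %-distribˡ-+ (toℕ a + 8) 8 16 ⟨
  (toℕ a + 8 + 8) % 16               ≡⟨ cong (_% 16) (+-assoc (toℕ a) 8 8) ⟩
  (toℕ a + 16) % 16                  ≡⟨ [m+n]%n≡m%n (toℕ a) 16 ⟩
  toℕ a % 16                         ≡⟨ m<n⇒m%n≡m (toℕ<n a) ⟩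
  toℕ a                              ∎
  where open ≡-Reasoning

Antipodal-functional : ∀ {a b c} → Antipodal a b → Antipodal a c → b ≡ c
Antipodal-functional ab ac = toℕ-injective (trans (sym ab) ac)

antipode : Fin 16 → Fin 16
antipode a = fromℕ< (m%n<n (toℕ a + 8) 16)

Antipodal-antipode : ∀ a → Antipodal a (antipode a)
Antipodal-antipode a = sym (toℕ-fromℕ< (m%n<n (toℕ a + 8) 16))

label : Fin 16 → Fin 16
label = lookup (# 2 ∷ # 11 ∷ # 3 ∷ # 15 ∷ # 7 ∷ # 14 ∷ # 6 ∷ # 13 ∷
                # 5 ∷ # 9 ∷ # 1 ∷ # 12 ∷ # 4 ∷ # 8 ∷ # 0 ∷ # 10 ∷ [])

position : Fin 16 → Fin 16
position = lookup (# 14 ∷ # 10 ∷ # 0 ∷ # 2 ∷ # 12 ∷ # 8 ∷ # 6 ∷ # 4 ∷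
                   # 13 ∷ # 9 ∷ # 15 ∷ # 1 ∷ # 11 ∷ # 7 ∷ # 5 ∷ # 3 ∷ [])

label-position : ∀ a → label (position a) ≡ a
label-position = from-yes (all? λ a → label (position a) ≟ᶠ a)

position-label : ∀ i → position (label i) ≡ i
position-label = from-yes (all? λ i → position (label i) ≟ᶠ i)

Adjacent : Fin 16 → Fin 16 → Set
Adjacent a b = CycAdjacent (position a) (position b)

private
  adjacent? : ∀ a b → Dec (Adjacent a b)
  adjacent? a b = (toℕ (position b) ≟ suc (toℕ (position a)) % 16)
           ⊎-dec (toℕ (position a) ≟ suc (toℕ (position b)) % 16)

  matched? : ∀ a b → Dec (Matched a b)
  matched? a b = ((toℕ a , toℕ b) ∈? I11') ⊎-dec ((toℕ b , toℕ a) ∈? I11')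

  antipodal? : ∀ a b → Dec (Antipodal a b)
  antipodal? a b = (toℕ a + 8) % 16 ≟ toℕ b

  adjacent⇒matched⊎antipodal : ∀ a b → Adjacent a b → Matched a b ⊎ Antipodal a b
  adjacent⇒matched⊎antipodal =
    from-yes (all? λ a → all? λ b → adjacent? a b →-dec (matched? a b ⊎-dec antipodal? a b))

  matched⊎antipodal⇒adjacent : ∀ a b → Matched a b ⊎ Antipodal a b → Adjacent a b
  matched⊎antipodal⇒adjacent =
    from-yes (all? λ a → all? λ b → (matched? a b ⊎-dec antipodal? a b) →-dec adjacent? a b)

Adjacent⇔Matched⊎Antipodal : ∀ a b → Adjacent a b ⇔ (Matched a b ⊎ Antipodal a b)
Adjacent⇔Matched⊎Antipodal a b =
  mk⇔ (adjacent⇒matched⊎antipodal a b) (matched⊎antipodal⇒adjacent a b)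

-- Matched edges of the label cycle join positions 2t, 2t+1 and antipodal ones 2t+1, 2t+2,
-- so a lift of the cycle changes column exactly between positions 4t+1, 4t+2 and 4t+3, 4t+4.
upper : Fin 16 → Bool
upper a = 2 ≤ᵇ toℕ (position a) % 4

upper-Matched : ∀ a b → Matched a b → upper b ≡ upper a
upper-Matched = from-yes (all? λ a → all? λ b → matched? a b →-dec (upper b ≟ᵇ upper a))

upper-Antipodal : ∀ a b → Antipodal a b → upper b ≡ not (upper a)
upper-Antipodal = from-yes (all? λ a → all? λ b → antipodal? a b →-dec (upper b ≟ᵇ not (upper a)))

module Construction (k : ℕ) where

  m : ℕ
  m = suc k

  column : Bool → Fin m → Fin m
  column false j = j
  column true  j = succ j

  cycleAt : Bool → Fin m → Fin m
  cycleAt false x = x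
  cycleAt true  x = pred x

  column-cycleAt : ∀ s x → column s (cycleAt s x) ≡ x
  column-cycleAt false x = refl
  column-cycleAt true  x = succ-pred x

  cycleAt-column : ∀ s j → cycleAt s (column s j) ≡ j
  cycleAt-column false j = refl
  cycleAt-column true  j = pred-succ j

  cycleAt-injective : ∀ s {x y} → cycleAt s x ≡ cycleAt s y → x ≡ y
  cycleAt-injective s {x} {y} e = begin
    x                        ≡⟨ column-cycleAt s x ⟨
    column s (cycleAt s x)   ≡⟨ cong (column s) e ⟩
    column s (cycleAt s y)   ≡⟨ column-cycleAt s y ⟩
    y                        ∎
    where open ≡-Reasoning

  cycleAt-opposite : ∀ s {x y} → cycleAt s x ≡ cycleAt (not s) y →
                     (s ≡ false × Succ x y) ⊎ (s ≡ true × Succ y x)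
  cycleAt-opposite false {y = y} refl = inj₁ (refl , Succ-pred y)
  cycleAt-opposite true  {x = x} refl = inj₂ (refl , Succ-pred x)

  cycles : Fin m → Fin 16 → V m
  cycles j i = column (upper (label i)) j , label i

  place : V m → Fin m × Fin 16
  place (x , a) = cycleAt (upper a) x , position a

  cycles-place : ∀ v → cycles (proj₁ (place v)) (proj₂ (place v)) ≡ v
  cycles-place (x , a) = trans (cong (λ b → column (upper b) (cycleAt (upper a) x) , b) (label-position a))
                                (cong (_, a) (column-cycleAt (upper a) x))

  place-cycles : ∀ j i → place (cycles j i) ≡ (j , i)
  place-cycles j i = cong₂ _,_ (cycleAt-column (upper (label i)) j) (position-label i)

  F : Graph m
  F = CyclesGraph cycles

  data Step : V m → V m → Set where
    step : ∀ {x y a b} → Succ x y → Antipodal a b → Step (x , a) (y , b)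

  sideOf : V m → Bool
  sideOf (_ , a) = upper a

  StepFrom : Bool → Graph m
  StepFrom s u v = Step u v × sideOf u ≡ s

  M : Graph m
  M = SymClosure (StepFrom true)

  side-Step : ∀ {u v} → Step u v → sideOf v ≡ not (sideOf u)
  side-Step (step {a = a} {b} _ ab) = upper-Antipodal a b ab

  Cay⇒Step : ∀ {u v} → Cay m u v → SymClosure Step u v
  Cay⇒Step                 (inj₁ x→y , ab) = fwd (step x→y ab)
  Cay⇒Step {_ , a} {_ , b} (inj₂ y→x , ab) = bwd (step y→x (Antipodal-sym a b ab))

  Step⇒Cay : ∀ {u v} → SymClosure Step u v → Cay m u v
  Step⇒Cay (fwd (step x→y ab))              = inj₁ x→y , ab
  Step⇒Cay (bwd (step {a = b} {a} y→x ba)) = inj₂ y→x , Antipodal-sym b a ba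

  Step-asymmetric : 3 ≤ m → ∀ {u v} → Step u v → Step v u → ⊥
  Step-asymmetric 3≤m (step x→y _) (step y→x _) = SuccMod-asymmetric 3≤m x→y y→x

  F⇔Consecutive : ∀ u v → F u v ⇔ Consecutive cycles place cycles-place place-cycles u v
  F⇔Consecutive = CyclesGraph⇔Consecutive cycles place cycles-place place-cycles

  mI11'⇒F : ∀ {u v} → mI11' m u v → F u v
  mI11'⇒F {x , a} {_ , b} (refl , ab) = Equivalence.from (F⇔Consecutive _ _)
    ( cong (λ s → cycleAt s x) (sym (upper-Matched a b ab))
    , Equivalence.from (Adjacent⇔Matched⊎Antipodal a b) (inj₁ ab))

  lowerStep⇒F : ∀ {u v} → StepFrom false u v → F u v
  lowerStep⇒F (step {x} {y} {a} {b} x→y ab , a-lower) = Equivalence.from (F⇔Consecutive _ _)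
    (same , Equivalence.from (Adjacent⇔Matched⊎Antipodal a b) (inj₂ ab))
    where
    open ≡-Reasoning
    b-upper : upper b ≡ true
    b-upper = trans (upper-Antipodal a b ab) (cong not a-lower)
    same : cycleAt (upper a) x ≡ cycleAt (upper b) y
    same = begin
      cycleAt (upper a) x   ≡⟨ cong (λ s → cycleAt s x) a-lower ⟩
      x                     ≡⟨ Succ⇒≡pred x→y ⟩
      pred y                ≡⟨ cong (λ s → cycleAt s y) b-upper ⟨
      cycleAt (upper b) y   ∎

  antipodal⇒lowerStep : ∀ {x y} a b → Antipodal a b → cycleAt (upper a) x ≡ cycleAt (upper b) y →
                        SymClosure (StepFrom false) (x , a) (y , b)
  antipodal⇒lowerStep {y = y} a b ab same
    with cycleAt-opposite (upper a) (trans same (cong (λ s → cycleAt s y) (upper-Antipodal a b ab)))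
  ... | inj₁ (a-lower , x→y) = fwd (step x→y ab , a-lower)
  ... | inj₂ (a-upper , y→x) =
    bwd (step y→x (Antipodal-sym a b ab) , trans (upper-Antipodal a b ab) (cong not a-upper))

  matched⇒sameColumn : ∀ {x y} a b → Matched a b → cycleAt (upper a) x ≡ cycleAt (upper b) y → x ≡ y
  matched⇒sameColumn {y = y} a b ab same =
    cycleAt-injective (upper a) (trans same (cong (λ s → cycleAt s y) (upper-Matched a b ab)))

  F⇒ : ∀ {u v} → F u v → mI11' m u v ⊎ SymClosure (StepFrom false) u v
  F⇒ {x , a} {y , b} f = classify (Equivalence.to (F⇔Consecutive (x , a) (y , b)) f)
    where
    classify : cycleAt (upper a) x ≡ cycleAt (upper b) y × Adjacent a b →
               mI11' m (x , a) (y , b) ⊎ SymClosure (StepFrom false) (x , a) (y , b)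
    classify (same , adj) =
      [ (λ ab → inj₁ (matched⇒sameColumn a b ab same , ab))
      , (λ ab → inj₂ (antipodal⇒lowerStep a b ab same))
      ]′ (Equivalence.to (Adjacent⇔Matched⊎Antipodal a b) adj)

  Step⇒F⊎M : ∀ {u v} → Step u v → F u v ⊎ M u v
  Step⇒F⊎M {u} st with sideOf u in side
  ... | false = inj₁ (lowerStep⇒F (st , side))
  ... | true  = inj₂ (fwd (st , side))

  G⇒F⊎M : ∀ u v → (Cay m ∪G mI11' m) u v → F u v ⊎ M u v
  G⇒F⊎M u v (inj₂ i) = inj₁ (mI11'⇒F i)
  G⇒F⊎M u v (inj₁ c) with Cay⇒Step c
  ... | fwd st = Step⇒F⊎M st
  ... | bwd st = Data.Sum.map CyclesGraph-sym (symmetric (StepFrom true)) (Step⇒F⊎M st)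

  F⇒G : ∀ u v → F u v → (Cay m ∪G mI11' m) u v
  F⇒G u v f = [ inj₂ , (λ s → inj₁ (Step⇒Cay (Sym.map proj₁ s))) ]′ (F⇒ f)

  M⇒G : ∀ u v → M u v → (Cay m ∪G mI11' m) u v
  M⇒G u v s = inj₁ (Step⇒Cay (Sym.map proj₁ s))

  mI11'-Step-disjoint : ∀ {u v} → mI11' m u v → SymClosure Step u v → ⊥
  mI11'-Step-disjoint {_ , a} {_ , b} (_ , ab) (fwd st) = not-¬ (upper-Matched a b ab) (side-Step st)
  mI11'-Step-disjoint {_ , a} {_ , b} (_ , ab) (bwd st) = not-¬ (sym (upper-Matched a b ab)) (side-Step st)

  lower-upper-disjoint : 3 ≤ m → ∀ {u v} →
    SymClosure (StepFrom false) u v → SymClosure (StepFrom true) u v → ⊥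
  lower-upper-disjoint _   (fwd (_ , f))  (fwd (_ , t))  = not-¬ t f
  lower-upper-disjoint 3≤m (fwd (st , _)) (bwd (ts , _)) = Step-asymmetric 3≤m st ts
  lower-upper-disjoint 3≤m (bwd (st , _)) (fwd (ts , _)) = Step-asymmetric 3≤m ts st
  lower-upper-disjoint _   (bwd (_ , f))  (bwd (_ , t))  = not-¬ t f

  F-M-disjoint : 3 ≤ m → ∀ u v → ¬ (F u v × M u v)
  F-M-disjoint 3≤m u v (f , s) =
    [ (λ i → mI11'-Step-disjoint i (Sym.map proj₁ s)) , (λ l → lower-upper-disjoint 3≤m l s) ]′ (F⇒ f)

  M-unique : ∀ u → Σ (V m) λ v → M u v × (∀ w → M u w → w ≡ v)
  M-unique (x , a) with upper a in a-side
  ... | true  = (succ x , antipode a) , fwd (step (Succ-succ x) (Antipodal-antipode a) , a-side) , only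
    where
    only : ∀ w → M (x , a) w → w ≡ (succ x , antipode a)
    only (y , b) (fwd (step x→y ab , _)) =
      cong₂ _,_ (Succ⇒≡succ x→y) (Antipodal-functional {a} ab (Antipodal-antipode a))
    only (y , b) (bwd (step _ ba , b-upper)) =
      ⊥-elim (not-¬ (trans a-side (sym b-upper)) (upper-Antipodal b a ba))
  ... | false = (pred x , antipode a)
              , bwd (step (Succ-pred x) (Antipodal-sym a (antipode a) (Antipodal-antipode a))
                    , trans (upper-Antipodal a (antipode a) (Antipodal-antipode a)) (cong not a-side))
              , only
    where
    only : ∀ w → M (x , a) w → w ≡ (pred x , antipode a)
    only (y , b) (fwd (_ , a-upper)) = ⊥-elim (not-¬ a-upper a-side)
    only (y , b) (bwd (step y→x ba , _)) =
      cong₂ _,_ (Succ⇒≡pred y→x) (Antipodal-functional {a} (Antipodal-sym b a ba) (Antipodal-antipode a))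

  decomposition : 3 ≤ m → DecompC16And1Factor m (Cay m ∪G mI11' m)
  decomposition 3≤m =
    F , M ,
    (m , cycles , visited-once cycles place cycles-place place-cycles , λ u v → id , id) ,
    ((λ u v → symmetric (StepFrom true)) , M-unique) ,
    λ u v → G⇒F⊎M u v , F⇒G u v , M⇒G u v , F-M-disjoint 3≤m u v

lemma2p12 : (m : ℕ) → 3 ≤ m → DecompC16And1Factor m (Cay m ∪G mI11' m)
lemma2p12 zero    ()
lemma2p12 (suc k) 3≤m = Construction.decomposition k 3≤m
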